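{- Let $n$ be a positive integer. If there exists a Sarvate--Beam cube of order $n$, then there exists a Sarvate--Beam cube of order $mn$ for every positive integer $m$.
   Context: For a positive integer $N$, a Sarvate--Beam cube of order $N$ is a function $C:[N]^3\to\mathbb{Z}_{\ge 0}$ (where $[N]=\{1,\dots,N\}$) such that its $3N^2$ line sums — namely $\sum_k C(i,j,k)$ over all $(i,j)$, $\sum_j C(i,j,k)$ over all $(i,k)$, and $\sum_i C(i,j,k)$ over all $(j,k)$ — are exactly the integers $0,1,\dots,3N^2-1$, each occurring once. -}

module Defs where

open import Data.Nat using (ℕ; _*_; _<_)
open import Data.Fin using (Fin; zero; suc)
open import Data.Fin.Patterns using (0F; 1F; 2F)
open import Data.Product using (Σ; _×_; _,_)
open import Relation.Binary.PropositionalEquality using (_≡_)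

∑ : {N : ℕ} → (Fin N → ℕ) → ℕ
∑ {ℕ.zero}  f = 0
∑ {ℕ.suc N} f = f zero Data.Nat.+ ∑ (λ i → f (suc i))

Cube : ℕ → Set
Cube N = Fin N → Fin N → Fin N → ℕ

LineIndex : ℕ → Set
LineIndex N = Fin 3 × Fin N × Fin N

lineSum : {N : ℕ} → Cube N → LineIndex N → ℕ
lineSum C (0F , a , b) = ∑ (λ k → C a b k)
lineSum C (1F , a , b) = ∑ (λ j → C a j b)
lineSum C (2F , a , b) = ∑ (λ i → C i a b)

∃! : {A : Set} → (A → Set) → Set
∃! {A} P = Σ A (λ x → P x × ((y : A) → P y → y ≡ x))

IsSarvateBeam : {N : ℕ} → Cube N → Set
IsSarvateBeam {N} C =
  ((x : LineIndex N) → lineSum C x < 3 * (N * N)) ×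
  ((v : ℕ) → v < 3 * (N * N) → ∃! (λ x → lineSum C x ≡ v))

SarvateBeamExists : ℕ → Set
SarvateBeamExists N = Σ (Cube N) IsSarvateBeam

{-# OPTIONS --safe #-}
-- Blow up a cube C of order n by a Latin square ∙ of order m (on blocks) and a
-- Latin square ∘ of order n (inside blocks):
--   D((p,a),(q,b),(r,c)) = [r = p ∙ q] · (C(a,b,c) + 3n² · [c = a ∘ b] · (m p + q)).
-- Every line of D meets exactly one block on which D is nonzero, and inside it
-- exactly one cell carrying the extra term, so each line sum of D is a line sum of C
-- plus 3n² times a block label t ∈ [0, m²).  The Latin property makes
-- (line of D) ↦ (line of C, t) a bijection, so the line sums of D are the
-- base-3n² numerals s + 3n² t, which enumerate [0, 3(mn)²) exactly once.
module Submission where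

open import Algebra.Core using (Op₂)
open import Algebra.Structures using (IsQuasigroup)
open import Data.Fin using (Fin; zero; suc; toℕ; fromℕ<; combine; remQuot; _↑ˡ_; _↑ʳ_; _≟_)
open import Data.Fin.Patterns using (0F; 1F; 2F)
open import Data.Fin.Properties
  using (toℕ-injective; toℕ<n; toℕ-fromℕ<; toℕ-combine; combine-injective; remQuot-combine; combine-remQuot)
  renaming (suc-injective to Fin-suc-injective)
open import Data.Nat using (ℕ; zero; suc; _+_; _*_; _∸_; _<_; NonZero)
open import Data.Nat.DivMod using (_%_; _mod_; %-distribˡ-+; m%n%n≡m%n; [m+n]%n≡m%n; m<n⇒m%n≡m)
open import Data.Nat.Properties
  using (+-comm; +-assoc; +-identityʳ; *-zeroʳ; *-distribˡ-+; <⇒≤; m+[n∸m]≡n; m∸n+n≡m; +-commutativeSemigroup)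
open import Data.Nat.Tactic.RingSolver using (solve-∀)
open import Data.Product using (∃; _×_; _,_; proj₁; proj₂; uncurry)
open import Function using (_∘_; _↔_; Inverse; mk↔ₛ′)
open import Relation.Nullary using (Dec; yes; no; contradiction)
open import Relation.Binary.PropositionalEquality

open import Defs
open import Algebra.Properties.CommutativeSemigroup +-commutativeSemigroup using (interchange)

𝟙 : {P : Set} → Dec P → ℕ
𝟙 (yes _) = 1
𝟙 (no _)  = 0

∑-cong : ∀ {k} {f g : Fin k → ℕ} → (∀ i → f i ≡ g i) → ∑ f ≡ ∑ g
∑-cong {zero}  f≗g = refl
∑-cong {suc k} f≗g = cong₂ _+_ (f≗g zero) (∑-cong (f≗g ∘ suc))

∑-zero : ∀ k → ∑ {k} (λ _ → 0) ≡ 0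
∑-zero zero    = refl
∑-zero (suc k) = ∑-zero k

∑-distrib-+ : ∀ {k} (f g : Fin k → ℕ) → ∑ (λ i → f i + g i) ≡ ∑ f + ∑ g
∑-distrib-+ {zero}  f g = refl
∑-distrib-+ {suc k} f g = trans (cong (f zero + g zero +_) (∑-distrib-+ (f ∘ suc) (g ∘ suc)))
                                (interchange (f zero) (g zero) (∑ (f ∘ suc)) (∑ (g ∘ suc)))

∑-*ˡ : ∀ {k} c (f : Fin k → ℕ) → ∑ (λ i → c * f i) ≡ c * ∑ f
∑-*ˡ {zero}  c f = sym (*-zeroʳ c)
∑-*ˡ {suc k} c f = trans (cong (c * f zero +_) (∑-*ˡ c (f ∘ suc))) (sym (*-distribˡ-+ c (f zero) _))

∑-↑ : ∀ a {b} (f : Fin (a + b) → ℕ) → ∑ f ≡ ∑ (λ i → f (i ↑ˡ b)) + ∑ (λ j → f (a ↑ʳ j))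
∑-↑ zero    f = refl
∑-↑ (suc a) f = trans (cong (f zero +_) (∑-↑ a (f ∘ suc))) (sym (+-assoc (f zero) _ _))

∑-combine : ∀ m {n} (f : Fin (m * n) → ℕ) → ∑ f ≡ ∑ {m} (λ i → ∑ {n} (λ j → f (combine i j)))
∑-combine zero        f = refl
∑-combine (suc m) {n} f =
  trans (∑-↑ n f) (cong (∑ (λ j → f (combine {suc m} zero j)) +_) (∑-combine m (λ i → f (n ↑ʳ i))))

∑-remQuot : ∀ m {n} (g : Fin m × Fin n → ℕ) →
            ∑ (λ z → g (remQuot n z)) ≡ ∑ (λ i → ∑ (λ j → g (i , j)))
∑-remQuot m {n} g = trans (∑-combine m {n} _) (∑-cong λ i → ∑-cong λ j → cong g (remQuot-combine i j))

∑-𝟙-* : ∀ {k} {P : Fin k → Set} (P? : ∀ i → Dec (P i)) (u : ∃! P) (f : Fin k → ℕ) →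
        ∑ (λ i → 𝟙 (P? i) * f i) ≡ f (proj₁ u)
∑-𝟙-* {suc k} P? (zero , Px , unique) f with P? zero
... | no ¬P0 = contradiction Px ¬P0
... | yes _  = begin
  f zero + 0 + ∑ (λ i → 𝟙 (P? (suc i)) * f (suc i)) ≡⟨ cong (f zero + 0 +_) (trans (∑-cong outside) (∑-zero k)) ⟩
  f zero + 0 + 0                                    ≡⟨ trans (+-identityʳ _) (+-identityʳ _) ⟩
  f zero                                            ∎
  where
  open ≡-Reasoning
  outside : ∀ i → 𝟙 (P? (suc i)) * f (suc i) ≡ 0
  outside i with P? (suc i)
  ... | yes P[1+i] with () ← unique (suc i) P[1+i]
  ... | no _ = refl
∑-𝟙-* {suc k} P? (suc x , Px , unique) f with P? zero
... | yes P0 with () ← unique zero P0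
... | no _   = ∑-𝟙-* (P? ∘ suc) (x , Px , λ y Py → Fin-suc-injective (unique (suc y) Py)) (f ∘ suc)

module _ {k} {_∙_ _\\_ _//_ : Op₂ (Fin k)} (isQuasigroup : IsQuasigroup _≡_ _∙_ _\\_ _//_) where
  open IsQuasigroup isQuasigroup using (leftDividesˡ; leftDividesʳ; rightDividesˡ; rightDividesʳ)

  ∃!-right-factor : ∀ p r → ∃! (λ q → r ≡ p ∙ q)
  ∃!-right-factor p r =
    p \\ r , sym (leftDividesˡ p r) , λ q r≡pq → trans (sym (leftDividesʳ p q)) (cong (p \\_) (sym r≡pq))

  ∃!-left-factor : ∀ q r → ∃! (λ p → r ≡ p ∙ q)
  ∃!-left-factor q r =
    r // q , sym (rightDividesˡ q r) , λ p r≡pq → trans (sym (rightDividesʳ q p)) (cong (_// q) (sym r≡pq))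

module Cyclic (k : ℕ) .{{_ : NonZero k}} where

  _∙_ _\\_ _//_ : Op₂ (Fin k)
  p ∙ q  = (toℕ p + toℕ q) mod k
  p \\ r = (k ∸ toℕ p + toℕ r) mod k
  r // q = q \\ r

  private
    toℕ-mod : ∀ x → toℕ (x mod k) ≡ x % k
    toℕ-mod x = toℕ-fromℕ< _

    reduce : ∀ a b {r} → a + b ≡ r + k → r < k → toℕ ((a + toℕ (b mod k)) mod k) ≡ r
    reduce a b {r} a+b≡r+k r<k = begin
      toℕ ((a + toℕ (b mod k)) mod k) ≡⟨ trans (toℕ-mod _) (cong (λ z → (a + z) % k) (toℕ-mod b)) ⟩
      (a + b % k) % k                 ≡⟨ %-distribˡ-+ a (b % k) k ⟩
      (a % k + b % k % k) % k         ≡⟨ cong (λ z → (a % k + z) % k) (m%n%n≡m%n b k) ⟩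
      (a % k + b % k) % k             ≡⟨ %-distribˡ-+ a b k ⟨
      (a + b) % k                     ≡⟨ cong (_% k) a+b≡r+k ⟩
      (r + k) % k                     ≡⟨ [m+n]%n≡m%n r k ⟩
      r % k                           ≡⟨ m<n⇒m%n≡m r<k ⟩
      r                               ∎
      where open ≡-Reasoning

    ∙-comm : ∀ p q → p ∙ q ≡ q ∙ p
    ∙-comm p q = cong (_mod k) (+-comm (toℕ p) (toℕ q))

    ∙-\\ : ∀ p r → p ∙ (p \\ r) ≡ r
    ∙-\\ p r = toℕ-injective (reduce (toℕ p) (k ∸ toℕ p + toℕ r) p+[k∸p+r]≡r+k (toℕ<n r))
      where
      p≤k = <⇒≤ (toℕ<n p)
      p+[k∸p+r]≡r+k = trans (sym (+-assoc (toℕ p) _ _)) (trans (cong (_+ toℕ r) (m+[n∸m]≡n p≤k)) (+-comm k _))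

    \\-∙ : ∀ p q → p \\ (p ∙ q) ≡ q
    \\-∙ p q = toℕ-injective (reduce (k ∸ toℕ p) (toℕ p + toℕ q) k∸p+[p+q]≡q+k (toℕ<n q))
      where
      p≤k = <⇒≤ (toℕ<n p)
      k∸p+[p+q]≡q+k = trans (sym (+-assoc (k ∸ toℕ p) _ _)) (trans (cong (_+ toℕ q) (m∸n+n≡m p≤k)) (+-comm k _))

  isQuasigroup : IsQuasigroup _≡_ _∙_ _\\_ _//_
  isQuasigroup = record
    { isMagma      = record { isEquivalence = isEquivalence ; ∙-cong = cong₂ _∙_ }
    ; \\-cong      = cong₂ _\\_
    ; //-cong      = cong₂ _//_
    ; leftDivides  = ∙-\\ , \\-∙
    ; rightDivides = (λ q r → trans (∙-comm (q \\ r) q) (∙-\\ q r))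
                   , (λ q p → trans (cong (q \\_) (∙-comm p q)) (\\-∙ q p))
    }

isSarvateBeam-by-bijection : ∀ {N K} {D : Cube N} (code : LineIndex N → Fin K) → K ≡ 3 * (N * N) →
  (∀ ℓ → toℕ (code ℓ) ≡ lineSum D ℓ) →
  (∀ {ℓ ℓ′} → code ℓ ≡ code ℓ′ → ℓ ≡ ℓ′) → (∀ w → ∃ λ ℓ → code ℓ ≡ w) → IsSarvateBeam D
isSarvateBeam-by-bijection {D = D} code refl toℕ-code code-injective code-surjective = bounded , unique
  where
  bounded : ∀ ℓ → lineSum D ℓ < _
  bounded ℓ = subst (_< _) (toℕ-code ℓ) (toℕ<n (code ℓ))

  unique : ∀ v → v < _ → ∃! (λ ℓ → lineSum D ℓ ≡ v)
  unique v v<K = ℓ , sum-ℓ , λ ℓ′ e → code-injective (toℕ-injective (trans (toℕ-code ℓ′) (trans e (sym toℕ-code-ℓ))))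
    where
    w = fromℕ< v<K
    ℓ = proj₁ (code-surjective w)
    toℕ-code-ℓ : toℕ (code ℓ) ≡ v
    toℕ-code-ℓ = trans (cong toℕ (proj₂ (code-surjective w))) (toℕ-fromℕ< v<K)
    sum-ℓ : lineSum D ℓ ≡ v
    sum-ℓ = trans (sym (toℕ-code ℓ)) toℕ-code-ℓ

isSarvateBeam-transfer : ∀ {n N M} {C : Cube n} {D : Cube N} → IsSarvateBeam C →
  (lines : LineIndex N ↔ (LineIndex n × Fin M)) → 3 * (N * N) ≡ M * (3 * (n * n)) →
  (∀ ℓ → let (c , t) = Inverse.to lines ℓ in lineSum D ℓ ≡ lineSum C c + 3 * (n * n) * toℕ t) →
  IsSarvateBeam D
isSarvateBeam-transfer {n} {N} {M} {C} {D} (bounded , unique) lines size lineSum-D =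
  isSarvateBeam-by-bijection code (sym size) toℕ-code code-injective code-surjective
  where
  open Inverse lines using (to; from; strictlyInverseˡ; strictlyInverseʳ)
  S = 3 * (n * n)

  digit : LineIndex n → Fin S
  digit c = fromℕ< (bounded c)

  code : LineIndex N → Fin (M * S)
  code ℓ = let (c , t) = to ℓ in combine t (digit c)

  toℕ-code : ∀ ℓ → toℕ (code ℓ) ≡ lineSum D ℓ
  toℕ-code ℓ = let (c , t) = to ℓ in begin
    toℕ (combine t (digit c))  ≡⟨ toℕ-combine t (digit c) ⟩
    S * toℕ t + toℕ (digit c)  ≡⟨ cong (S * toℕ t +_) (toℕ-fromℕ< (bounded c)) ⟩
    S * toℕ t + lineSum C c    ≡⟨ +-comm (S * toℕ t) _ ⟩
    lineSum C c + S * toℕ t    ≡⟨ lineSum-D ℓ ⟨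
    lineSum D ℓ                ∎
    where open ≡-Reasoning

  digit-injective : ∀ {c c′} → digit c ≡ digit c′ → c ≡ c′
  digit-injective {c} {c′} e = trans (same c refl) (sym (same c′ (sym sums≡)))
    where
    sums≡ : lineSum C c ≡ lineSum C c′
    sums≡ = trans (sym (toℕ-fromℕ< (bounded c))) (trans (cong toℕ e) (toℕ-fromℕ< (bounded c′)))
    same = proj₂ (proj₂ (unique (lineSum C c) (bounded c)))

  code-injective : ∀ {ℓ ℓ′} → code ℓ ≡ code ℓ′ → ℓ ≡ ℓ′
  code-injective {ℓ} {ℓ′} e = begin
    ℓ            ≡⟨ strictlyInverseʳ ℓ ⟨
    from (to ℓ)  ≡⟨ cong from (cong₂ _,_ (digit-injective (proj₂ parts)) (proj₁ parts)) ⟩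
    from (to ℓ′) ≡⟨ strictlyInverseʳ ℓ′ ⟩
    ℓ′           ∎
    where
    open ≡-Reasoning
    parts = combine-injective _ _ _ _ e

  code-surjective : ∀ w → ∃ λ ℓ → code ℓ ≡ w
  code-surjective w = from (c , t) , (begin
    code (from (c , t))     ≡⟨ cong (λ (c′ , t′) → combine t′ (digit c′)) (strictlyInverseˡ (c , t)) ⟩
    combine t (digit c)     ≡⟨ cong (combine t) (toℕ-injective (trans (toℕ-fromℕ< (bounded c)) sum-c≡s)) ⟩
    combine t s             ≡⟨ combine-remQuot {M} S w ⟩
    w                       ∎)
    where
    open ≡-Reasoning
    t = proj₁ (remQuot {M} S w)
    s = proj₂ (remQuot {M} S w)
    c = proj₁ (unique (toℕ s) (toℕ<n s))
    sum-c≡s = proj₁ (proj₂ (unique (toℕ s) (toℕ<n s)))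

∑∑-single-block : ∀ {k l} {P : Fin k → Set} {Q : Fin l → Set}
  (P? : ∀ i → Dec (P i)) (Q? : ∀ j → Dec (Q j)) (uP : ∃! P) (uQ : ∃! Q) (s : ℕ) (t : Fin k → ℕ) (h : Fin l → ℕ) →
  ∑ (λ i → ∑ (λ j → 𝟙 (P? i) * (h j + s * (𝟙 (Q? j) * t i)))) ≡ ∑ h + s * t (proj₁ uP)
∑∑-single-block P? Q? uP uQ s t h = begin
  ∑ (λ i → ∑ (λ j → 𝟙 (P? i) * (h j + s * (𝟙 (Q? j) * t i)))) ≡⟨ ∑-cong (λ i → ∑-*ˡ (𝟙 (P? i)) (λ j → h j + s * (𝟙 (Q? j) * t i))) ⟩
  ∑ (λ i → 𝟙 (P? i) * ∑ (λ j → h j + s * (𝟙 (Q? j) * t i)))   ≡⟨ ∑-𝟙-* P? uP _ ⟩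
  ∑ (λ j → h j + s * (𝟙 (Q? j) * x))                          ≡⟨ ∑-distrib-+ h _ ⟩
  ∑ h + ∑ (λ j → s * (𝟙 (Q? j) * x))                          ≡⟨ cong (∑ h +_) (∑-*ˡ s (λ j → 𝟙 (Q? j) * x)) ⟩
  ∑ h + s * ∑ (λ j → 𝟙 (Q? j) * x)                            ≡⟨ cong (λ z → ∑ h + s * z) (∑-𝟙-* Q? uQ _) ⟩
  ∑ h + s * x                                                 ∎
  where
  open ≡-Reasoning
  x = t (proj₁ uP)

module Product {m n} {_∙_ _\\_ _//_ : Op₂ (Fin m)} {_∘_ _\\ₙ_ _//ₙ_ : Op₂ (Fin n)}
  (outer : IsQuasigroup _≡_ _∙_ _\\_ _//_) (inner : IsQuasigroup _≡_ _∘_ _\\ₙ_ _//ₙ_) (C : Cube n) where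

  open IsQuasigroup outer using (leftDividesˡ; leftDividesʳ; rightDividesˡ; rightDividesʳ)

  coords : Fin (m * n) → Fin m × Fin n
  coords = remQuot {m} n

  labelPair : Fin (m * m) → Fin m × Fin m
  labelPair = remQuot {m} m

  S : ℕ
  S = 3 * (n * n)

  block : Fin m × Fin n → Fin m × Fin n → Fin m × Fin n → ℕ
  block (p , a) (q , b) (r , c) = 𝟙 (r ≟ p ∙ q) * (C a b c + S * (𝟙 (c ≟ a ∘ b) * toℕ (combine p q)))

  D : Cube (m * n)
  D x y z = block (coords x) (coords y) (coords z)

  -- the (x , y) block coordinates of the one nonzero block met by the line in direction d through block coordinates u
  blockLabel : Fin 3 → Fin m × Fin m → Fin m × Fin m
  blockLabel 0F (p , q) = p , q
  blockLabel 1F (p , r) = p , p \\ r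
  blockLabel 2F (q , r) = r // q , q

  unlabel : Fin 3 → Fin m × Fin m → Fin m × Fin m
  unlabel 0F (p , q) = p , q
  unlabel 1F (p , q) = p , p ∙ q
  unlabel 2F (p , q) = q , p ∙ q

  unlabel-blockLabel : ∀ d u → unlabel d (blockLabel d u) ≡ u
  unlabel-blockLabel 0F _       = refl
  unlabel-blockLabel 1F (p , r) = cong (p ,_) (leftDividesˡ p r)
  unlabel-blockLabel 2F (q , r) = cong (q ,_) (rightDividesˡ q r)

  blockLabel-unlabel : ∀ d u → blockLabel d (unlabel d u) ≡ u
  blockLabel-unlabel 0F _       = refl
  blockLabel-unlabel 1F (p , q) = cong (p ,_) (leftDividesʳ p q)
  blockLabel-unlabel 2F (p , q) = cong (_, q) (rightDividesʳ q p)

  lineCode : LineIndex (m * n) → LineIndex n × Fin (m * m)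
  lineCode (d , x , y) = let (p , a) = coords x ; (q , b) = coords y in
    (d , a , b) , uncurry combine (blockLabel d (p , q))

  lineDecode : LineIndex n × Fin (m * m) → LineIndex (m * n)
  lineDecode ((d , a , b) , t) = let (p , q) = unlabel d (labelPair t) in
    d , combine p a , combine q b

  lineDecode-lineCode : ∀ ℓ → lineDecode (lineCode ℓ) ≡ ℓ
  lineDecode-lineCode (d , x , y) = begin
    lineDecode (lineCode (d , x , y))                        ≡⟨ cong (λ (p′ , q′) → d , combine p′ a , combine q′ b) labels ⟩
    d , combine p a , combine q b                            ≡⟨ cong₂ (λ x′ y′ → d , x′ , y′) (combine-remQuot {m} n x) (combine-remQuot {m} n y) ⟩
    d , x , y                                                ∎
    where
    open ≡-Reasoning
    p = proj₁ (coords x)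
    a = proj₂ (coords x)
    q = proj₁ (coords y)
    b = proj₂ (coords y)
    labels : unlabel d (labelPair (uncurry combine (blockLabel d (p , q)))) ≡ (p , q)
    labels = trans (cong (unlabel d) (remQuot-combine _ _)) (unlabel-blockLabel d (p , q))

  lineCode-lineDecode : ∀ z → lineCode (lineDecode z) ≡ z
  lineCode-lineDecode ((d , a , b) , t) = begin
    lineCode (lineDecode ((d , a , b) , t))                  ≡⟨ cong₂ code (remQuot-combine p a) (remQuot-combine q b) ⟩
    (d , a , b) , uncurry combine (blockLabel d (p , q))     ≡⟨ cong (λ u → (d , a , b) , uncurry combine u) (blockLabel-unlabel d _) ⟩
    (d , a , b) , uncurry combine (labelPair t)              ≡⟨ cong ((d , a , b) ,_) (combine-remQuot {m} m t) ⟩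
    (d , a , b) , t                                          ∎
    where
    open ≡-Reasoning
    p = proj₁ (unlabel d (labelPair t))
    q = proj₂ (unlabel d (labelPair t))
    code : Fin m × Fin n → Fin m × Fin n → LineIndex n × Fin (m * m)
    code (p′ , a′) (q′ , b′) = (d , a′ , b′) , uncurry combine (blockLabel d (p′ , q′))

  lines↔ : LineIndex (m * n) ↔ (LineIndex n × Fin (m * m))
  lines↔ = mk↔ₛ′ lineCode lineDecode lineCode-lineDecode lineDecode-lineCode

  lineSum-D : ∀ ℓ → let (c , t) = lineCode ℓ in lineSum D ℓ ≡ lineSum C c + S * toℕ t
  lineSum-D (0F , x , y) = trans (∑-remQuot m (block (coords x) (coords y)))
    (∑∑-single-block (λ r → r ≟ p ∙ q) (λ c → c ≟ a ∘ b) (p ∙ q , refl , λ _ e → e) (a ∘ b , refl , λ _ e → e)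
                     S (λ _ → toℕ (combine p q)) (λ c → C a b c))
    where
    p = proj₁ (coords x)
    a = proj₂ (coords x)
    q = proj₁ (coords y)
    b = proj₂ (coords y)
  lineSum-D (1F , x , z) = trans (∑-remQuot m (λ w → block (coords x) w (coords z)))
    (∑∑-single-block (λ q → r ≟ p ∙ q) (λ b → c ≟ a ∘ b) (∃!-right-factor outer p r) (∃!-right-factor inner a c)
                     S (λ q → toℕ (combine p q)) (λ b → C a b c))
    where
    p = proj₁ (coords x)
    a = proj₂ (coords x)
    r = proj₁ (coords z)
    c = proj₂ (coords z)
  lineSum-D (2F , y , z) = trans (∑-remQuot m (λ w → block w (coords y) (coords z)))
    (∑∑-single-block (λ p → r ≟ p ∙ q) (λ a → c ≟ a ∘ b) (∃!-left-factor outer q r) (∃!-left-factor inner b c)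
                     S (λ p → toℕ (combine p q)) (λ a → C a b c))
    where
    q = proj₁ (coords y)
    b = proj₂ (coords y)
    r = proj₁ (coords z)
    c = proj₂ (coords z)

  isSarvateBeam : IsSarvateBeam C → IsSarvateBeam D
  isSarvateBeam sb = isSarvateBeam-transfer sb lines↔ (size m n) lineSum-D
    where
    size : ∀ m n → 3 * ((m * n) * (m * n)) ≡ (m * m) * (3 * (n * n))
    size = solve-∀

lemma1 : (n : ℕ) → .{{NonZero n}} → SarvateBeamExists n →
         (m : ℕ) → .{{NonZero m}} → SarvateBeamExists (m * n)
lemma1 n (C , sb) m = D , isSarvateBeam sb
  where open Product (Cyclic.isQuasigroup m) (Cyclic.isQuasigroup n) C
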